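{- Let $n,k$ be integers with $n\ge k>2$. There exists a universal cycle for the set of all functions $\{1,\dots,n\}\to\{1,\dots,k\}$ that are not onto, i.e., the $n$-letter words over the alphabet $[k]=\{1,\dots,k\}$ in which at least one letter of $[k]$ does not occur.
   Context: For a set $\mathcal{C}$ of $n$-letter words over an alphabet, a universal cycle (U-cycle) for $\mathcal{C}$ is a cyclic sequence $x_1x_2\dots x_N$ with $N=|\mathcal{C}|$ such that the $N$ words $x_ix_{i+1}\dots x_{i+n-1}$ ($1\le i\le N$, indices taken modulo $N$) are exactly the words of $\mathcal{C}$, each occurring exactly once. -}

module Defs where

open import Data.Nat using (ℕ; suc; _+_)
open import Data.Nat.DivMod using (_mod_)
open import Data.Fin using (Fin; toℕ)
open import Data.Vec using (Vec; tabulate)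
open import Data.Vec.Membership.Propositional using (_∈_)
open import Data.Product using (∃; ∃-syntax; _×_)
open import Relation.Nullary using (¬_)
open import Relation.Binary.PropositionalEquality using (_≡_)

Word : ℕ → ℕ → Set
Word n k = Vec (Fin k) n

NotOnto : ∀ {n k} → Word n k → Set
NotOnto {n} {k} w = ∃[ a ] ¬ (a ∈ w)

-- A cyclic sequence x₀ … x_{N-1} of length N = suc m (nonempty).
-- The window starting at position i: x_i x_{i+1} … x_{i+n-1}, indices mod N.
window : ∀ {m k} (n : ℕ) → (Fin (suc m) → Fin k) → Fin (suc m) → Word n k
window {m} n x i = tabulate (λ j → x ((toℕ i + toℕ j) mod suc m))

-- x is a universal cycle for the set of words satisfying C:
-- the N windows are pairwise distinct, each lies in C, and every word of C
-- is some window. (Hence N = |C| and each word occurs exactly once.)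
IsUCycle : ∀ {m k} (n : ℕ) → (Word n k → Set) → (Fin (suc m) → Fin k) → Set
IsUCycle {m} {k} n C x =
  (∀ i j → window n x i ≡ window n x j → i ≡ j) ×
  (∀ i → C (window n x i)) ×
  (∀ (w : Word n k) → C w → ∃[ i ] window n x i ≡ w)

module Submission where

-- A universal cycle for the non-onto words is an Eulerian circuit, read off
-- letter by letter, in the graph whose vertices are the words of length n and
-- whose edges are the non-onto words e of length n+1, from init e to tail e:
-- consecutive edges of a closed walk overlap in n letters, so the first
-- letters of its edges form a cyclic sequence whose windows are the edges.
--
-- It then reads a universal cycle off an
-- Eulerian circuit of the word graph, and checks that the non-onto edges are
-- balanced (v·a and a·v omit the same letters) and connected (through cⁿ for
-- a letter c avoiding two given ones, which needs k > 2).  The hypothesis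
-- k ≤ n only excludes n = 0.

open import Defs
open import Data.Nat using (ℕ; zero; suc; pred; _+_; _≤_; _<_; z≤n; s≤s; s<s⁻¹; _<?_; _%_)
open import Data.Nat.Properties
  using (+-identityʳ; +-suc; +-comm; n<1+n; ≤-trans; <⇒≤; 1+n≰n; <⇒≱; ≮⇒≥; ≤-antisym; module ≤-Reasoning)
open import Data.Nat.DivMod using (_mod_; m<n⇒m%n≡m; n%n≡0; %-distribˡ-+; m%n%n≡m%n)
open import Data.Fin using (Fin; zero; suc; toℕ; fromℕ<; inject₁)
open import Data.Fin.Properties using (_≟_; toℕ-injective; toℕ-fromℕ<; fromℕ<-cong; toℕ<n; toℕ-inject₁; any?)
open import Data.Vec using (Vec; []; _∷_; _∷ʳ_; init; last; initLast; tail; lookup; tabulate; replicate; toList)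
open import Data.Vec.Properties
  using (≡-dec; ∷-injectiveˡ; ∷ʳ-injectiveʳ; init-∷ʳ; toList-∷ʳ; toList-injective;
         tabulate-cong; tabulate∘lookup)
open import Data.Vec.Relation.Unary.Any using (here; there)
open import Data.Vec.Relation.Binary.Equality.Cast using (cast-is-id)
open import Data.Vec.Membership.Propositional using () renaming (_∈_ to _∈ᵥ_; _∉_ to _∉ᵥ_)
import Data.Vec.Membership.DecPropositional as VecMembership
open import Data.List using (List; []; _∷_; _++_; [_]; length; map; filter; drop; allFin; cartesianProductWith)
import Data.List as List using (lookup)
open import Data.List.Properties
  using (filter-accept; filter-reject; filter-≐; length-map; length-++; ++-assoc; ++-identityʳ; drop-drop)
open import Data.List.Relation.Unary.Any as Any using (Any; here; there; index)
open import Data.List.Relation.Unary.Any.Properties using (lookup-index; ++⁺ʳ)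
open import Data.List.Membership.Propositional using (_∈_; _∉_; find; lose)
open import Data.List.Membership.Propositional.Properties
  using (∈-∃++; ∈-++⁻; ∈-++⁺ˡ; ∈-map⁺; ∈-map⁻; ∈-filter⁺; ∈-filter⁻; ∈-allFin; ∈-lookup;
         ∈-cartesianProductWith⁺)
import Data.List.Membership.DecPropositional as ListMembership
open import Data.List.Relation.Unary.Unique.Propositional using (Unique; []; _∷_)
open import Data.List.Relation.Unary.Unique.Propositional.Properties
  using (map⁺; filter⁺; allFin⁺; ++⁺; Unique[x∷xs]⇒x∉xs)
open import Data.List.Relation.Binary.Permutation.Propositional
  using (_↭_; ↭-refl; ↭-prep; ↭-swap; ↭-sym; ↭-trans; ↭⇒↭ₛ)
open import Data.List.Relation.Binary.Permutation.Propositional.Properties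
  using (↭-length; ∈-resp-↭; shift; ++-comm; filter-↭)
import Data.List.Relation.Binary.Permutation.Setoid.Properties as SetoidPermutation
open import Data.List.Relation.Unary.All using ([])
open import Data.Product using (Σ-syntax; ∃-syntax; _×_; _,_; proj₂)
open import Data.Sum using (_⊎_; inj₁; inj₂)
open import Data.Bool using (true; false)
open import Function using (_∘_)
open import Relation.Nullary using (does; yes; no; ¬?; contradiction)
open import Relation.Nullary.Decidable using (_×-dec_)
open import Relation.Unary using (Decidable; _≐_)
open import Relation.Binary.Definitions using (DecidableEquality)
open import Relation.Binary.PropositionalEquality
  using (_≡_; _≢_; refl; sym; trans; cong; subst; setoid; module ≡-Reasoning)

record Listing {A : Set} (P : A → Set) : Set where
  field
    elems    : List A
    unique   : Unique elems
    sound    : ∀ {x} → x ∈ elems → P x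
    complete : ∀ {x} → P x → x ∈ elems

module _ {A : Set} where

  Unique-resp-↭ : {xs ys : List A} → xs ↭ ys → Unique xs → Unique ys
  Unique-resp-↭ p = SetoidPermutation.Unique-resp-↭ (setoid A) (↭⇒↭ₛ p)

  Unique-∷ʳ : {xs : List A} {x : A} → Unique xs → x ∉ xs → Unique (xs ++ [ x ])
  Unique-∷ʳ uniq x∉xs = ++⁺ uniq ([] ∷ []) λ { (y∈xs , here refl) → x∉xs y∈xs }

  ∈-++-[_]-elim : {P : A → Set} {xs : List A} (x : A) → (∀ {y} → y ∈ xs → P y) → P x →
                  ∀ {y} → y ∈ xs ++ [ x ] → P y
  ∈-++-[_]-elim {xs = xs} x all-xs px y∈ with ∈-++⁻ xs y∈
  ... | inj₁ y∈xs        = all-xs y∈xs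
  ... | inj₂ (here refl) = px

  Unique⇒length≤ : {xs ys : List A} → Unique xs → (∀ {z} → z ∈ xs → z ∈ ys) → length xs ≤ length ys
  Unique⇒length≤ {[]} _ _ = z≤n
  Unique⇒length≤ {x ∷ xs} {ys} uniq@(_ ∷ uniq′) xs⊆ys with ∈-∃++ (xs⊆ys (here refl))
  ... | ys₁ , ys₂ , refl = begin
    suc (length xs)           ≤⟨ s≤s (Unique⇒length≤ uniq′ xs⊆ys₁ys₂) ⟩
    suc (length (ys₁ ++ ys₂)) ≡⟨ ↭-length (↭-sym (shift x ys₁ ys₂)) ⟩
    length (ys₁ ++ x ∷ ys₂)   ∎
    where
    open ≤-Reasoning
    xs⊆ys₁ys₂ : ∀ {z} → z ∈ xs → z ∈ ys₁ ++ ys₂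
    xs⊆ys₁ys₂ z∈xs with ∈-resp-↭ (shift x ys₁ ys₂) (xs⊆ys (there z∈xs))
    ... | here refl = contradiction z∈xs (Unique[x∷xs]⇒x∉xs uniq)
    ... | there z∈  = z∈

  lookup-injective : {xs : List A} → Unique xs → ∀ {i j} → List.lookup xs i ≡ List.lookup xs j → i ≡ j
  lookup-injective {_ ∷ _}  _            {zero}  {zero}  _  = refl
  lookup-injective {_ ∷ xs} uniq         {zero}  {suc j} eq =
    contradiction (subst (_∈ xs) (sym eq) (∈-lookup j)) (Unique[x∷xs]⇒x∉xs uniq)
  lookup-injective {_ ∷ xs} uniq         {suc i} {zero}  eq =
    contradiction (subst (_∈ xs) eq (∈-lookup i)) (Unique[x∷xs]⇒x∉xs uniq)
  lookup-injective {_ ∷ _}  (_ ∷ uniq)   {suc i} {suc j} eq = cong suc (lookup-injective uniq eq)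

  length-filter-map : {B : Set} {P : B → Set} (P? : Decidable P) (f : A → B) (xs : List A) →
                      length (filter P? (map f xs)) ≡ length (filter (P? ∘ f) xs)
  length-filter-map P? f [] = refl
  length-filter-map P? f (x ∷ xs) with does (P? (f x))
  ... | true  = cong suc (length-filter-map P? f xs)
  ... | false = length-filter-map P? f xs

-- Walks and Eulerian circuits in a directed graph with vertices V and
-- edges E, where an edge e goes from src e to tgt e.

module Eulerian {V E : Set} (_≟ᵥ_ : DecidableEquality V) (_≟ₑ_ : DecidableEquality E)
                (src tgt : E → V) where

  open ListMembership _≟ₑ_ using (_∈?_)

  data Walk : V → V → List E → Set where
    []   : ∀ {v} → Walk v v []
    step : ∀ {u v e es} → src e ≡ u → Walk (tgt e) v es → Walk u v (e ∷ es)

  _++ʷ_ : ∀ {u w v A B} → Walk u w A → Walk w v B → Walk u v (A ++ B)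
  []         ++ʷ q = q
  (step s p) ++ʷ q = step s (p ++ʷ q)

  splitʷ : ∀ {u v} A {B} → Walk u v (A ++ B) → ∃[ w ] (Walk u w A × Walk w v B)
  splitʷ []      p          = _ , [] , p
  splitʷ (e ∷ A) (step s p) with splitʷ A p
  ... | w , p₁ , p₂ = w , step s p₁ , p₂

  walk-next : ∀ {u v T} → Walk u v T → (i : Fin (length T)) (p : suc (toℕ i) < length T) →
              tgt (List.lookup T i) ≡ src (List.lookup T (fromℕ< p))
  walk-next (step _ [])         zero    (s≤s ())
  walk-next (step _ (step s _)) zero    _ = sym s
  walk-next (step _ p)          (suc i) q = walk-next p i (s<s⁻¹ q)

  walk-last : ∀ {u v T} → Walk u v T → (i : Fin (length T)) → suc (toℕ i) ≡ length T →
              tgt (List.lookup T i) ≡ v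
  walk-last (step _ [])         zero    _  = refl
  walk-last (step _ p)          (suc i) eq = walk-last p i (cong pred eq)

  closed-walk-next : ∀ {u e T} → Walk u u (e ∷ T) → (i : Fin (suc (length T))) →
                     tgt (List.lookup (e ∷ T) i) ≡ src (List.lookup (e ∷ T) (suc (toℕ i) mod suc (length T)))
  closed-walk-next {u} {e} {T} c@(step s _) i with suc (toℕ i) <? suc (length T)
  ... | yes p = trans (walk-next c i p)
                  (cong (src ∘ List.lookup (e ∷ T)) (fromℕ<-cong _ _ (sym (m<n⇒m%n≡m p)) p _))
  ... | no ¬p = begin
    tgt (List.lookup (e ∷ T) i)  ≡⟨ walk-last c i i-last ⟩
    u                            ≡⟨ sym s ⟩
    src e                        ≡⟨ cong (src ∘ List.lookup (e ∷ T)) wraps ⟩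
    src (List.lookup (e ∷ T) (suc (toℕ i) mod suc (length T))) ∎
    where
    open ≡-Reasoning
    i-last : suc (toℕ i) ≡ suc (length T)
    i-last = ≤-antisym (toℕ<n i) (≮⇒≥ ¬p)
    wraps : zero ≡ suc (toℕ i) mod suc (length T)
    wraps = fromℕ<-cong 0 _ (sym (trans (cong (_% suc (length T)) i-last) (n%n≡0 (suc (length T)))))
                        (s≤s z≤n) _

  walk-balance : ∀ {u v T} → Walk u v T → v ∷ map src T ↭ u ∷ map tgt T
  walk-balance []            = ↭-refl
  walk-balance (step refl p) = ↭-trans (↭-swap _ _ ↭-refl) (↭-prep _ (walk-balance p))

  leaving entering : V → List E → List E
  leaving  v = filter (λ e → src e ≟ᵥ v)
  entering v = filter (λ e → tgt e ≟ᵥ v)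

  open-walk-count : ∀ {u v T} → Walk u v T → u ≢ v → suc (length (leaving v T)) ≡ length (entering v T)
  open-walk-count {u} {v} {T} p u≢v = begin
    suc (length (leaving v T))  ≡⟨ cong suc (sym (length-filter-map (_≟ᵥ v) src T)) ⟩
    suc (visits (map src T))    ≡⟨ cong length (sym (filter-accept (_≟ᵥ v) refl)) ⟩
    visits (v ∷ map src T)      ≡⟨ ↭-length (filter-↭ (_≟ᵥ v) (walk-balance p)) ⟩
    visits (u ∷ map tgt T)      ≡⟨ cong length (filter-reject (_≟ᵥ v) u≢v) ⟩
    visits (map tgt T)          ≡⟨ length-filter-map (_≟ᵥ v) tgt T ⟩
    length (entering v T)       ∎
    where
    open ≡-Reasoning
    visits : List V → ℕ
    visits vs = length (filter (_≟ᵥ v) vs)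

  OnCircuit : V → List E → V → Set
  OnCircuit u T w = ∃[ A ] ∃[ B ] (T ≡ A ++ B × Walk u w A × Walk w u B)

  tgt-on-circuit : ∀ {u T e} → Walk u u T → e ∈ T → OnCircuit u T (tgt e)
  tgt-on-circuit {e = e} c e∈T with ∈-∃++ e∈T
  ... | A , B , refl with splitʷ A c
  ... | _ , to-e , step s from-e =
    A ++ [ e ] , B , sym (++-assoc A [ e ] B) , to-e ++ʷ step s [] , from-e

  rotate : ∀ {u T w} → OnCircuit u T w → ∃[ T′ ] (T′ ↭ T × Walk w w T′)
  rotate (A , B , refl , to-w , from-w) = B ++ A , ++-comm B A , from-w ++ʷ to-w

  module EdgeSet (C : E → Set) where

    OutEdge InEdge : V → E → Set
    OutEdge v e = C e × src e ≡ v
    InEdge  v e = C e × tgt e ≡ v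

    Balanced : Set
    Balanced = ∀ v → Σ[ O ∈ Listing (OutEdge v) ] Σ[ I ∈ Listing (InEdge v) ]
                       length (Listing.elems O) ≡ length (Listing.elems I)

    Connected : Set
    Connected = ∀ {e f} → C e → C f → ∃[ P ] (Walk (tgt e) (src f) P × (∀ {d} → d ∈ P → C d))

    record EulerCircuit : Set where
      field
        start    : V
        edges    : List E
        walk     : Walk start start edges
        unique   : Unique edges
        sound    : ∀ {e} → e ∈ edges → C e
        complete : ∀ {e} → C e → e ∈ edges

    stuck⇒closed : Balanced → ∀ {u v T} → Walk u v T → Unique T → (∀ {e} → e ∈ T → C e) →
                   (∀ {e} → OutEdge v e → e ∈ T) → u ≡ v
    stuck⇒closed balanced {u} {v} {T} p uniq sound stuck with u ≟ᵥ v | balanced v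
    ... | yes u≡v | _           = u≡v
    ... | no  u≢v | O , I , O≡I = contradiction degree-count 1+n≰n
      where
      open ≤-Reasoning
      entering⊆I : ∀ {e} → e ∈ entering v T → e ∈ Listing.elems I
      entering⊆I e∈ with ∈-filter⁻ (λ e → tgt e ≟ᵥ v) {xs = T} e∈
      ... | e∈T , e↦v = Listing.complete I (sound e∈T , e↦v)
      O⊆leaving : ∀ {e} → e ∈ Listing.elems O → e ∈ leaving v T
      O⊆leaving e∈O with Listing.sound O e∈O
      ... | e∈C , v↦e = ∈-filter⁺ (λ e → src e ≟ᵥ v) (stuck (e∈C , v↦e)) v↦e
      degree-count : suc (length (leaving v T)) ≤ length (leaving v T)
      degree-count = begin
        suc (length (leaving v T))  ≡⟨ open-walk-count p u≢v ⟩
        length (entering v T)       ≤⟨ Unique⇒length≤ (filter⁺ _ uniq) entering⊆I ⟩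
        length (Listing.elems I)    ≡⟨ sym O≡I ⟩
        length (Listing.elems O)    ≤⟨ Unique⇒length≤ (Listing.unique O) O⊆leaving ⟩
        length (leaving v T)        ∎

    exit : ∀ {u T w x P} → Walk u u T → OnCircuit u T w → Walk w x P → (∀ {d} → d ∈ P → C d) →
           Any (_∉ T) P → ∃[ g ] (C g × g ∉ T × OnCircuit u T (src g))
    exit {T = T} c on (step {e = q} s p) inC off with q ∈? T
    ... | no  q∉T = q , inC (here refl) , q∉T , subst (OnCircuit _ _) (sym s) on
    ... | yes q∈T = exit c (tgt-on-circuit c q∈T) p (inC ∘ there) (Any.tail (λ q∉T → q∉T q∈T) off)

    -- Hierholzer's algorithm, for a balanced connected edge set C inside a
    -- finite edge type, started from an edge e₀ of C.
    module Hierholzer (C? : Decidable C) (allEdges : List E) (enumerates : ∀ e → e ∈ allEdges)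
                      (balanced : Balanced) (connected : Connected) {e₀ : E} (e₀∈C : C e₀) where

      record Trail : Set where
        field
          start end : V
          edges     : List E
          walk      : Walk start end edges
          unique    : Unique edges
          sound     : ∀ {e} → e ∈ edges → C e
          seed      : e₀ ∈ edges

      LongerThan : ℕ → Set
      LongerThan ℓ = Σ[ t ∈ Trail ] length (Trail.edges t) ≡ suc ℓ

      extend : (t : Trail) → ∀ {g} → C g → src g ≡ Trail.end t → g ∉ Trail.edges t →
               LongerThan (length (Trail.edges t))
      extend t {g} g∈C g-at-end g∉T = record
        { start  = Trail.start t
        ; end    = tgt g
        ; edges  = Trail.edges t ++ [ g ]
        ; walk   = Trail.walk t ++ʷ step g-at-end []
        ; unique = Unique-∷ʳ (Trail.unique t) g∉T
        ; sound  = ∈-++-[ g ]-elim (Trail.sound t) g∈C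
        ; seed   = ∈-++⁺ˡ (Trail.seed t)
        } , trans (length-++ (Trail.edges t)) (+-comm (length (Trail.edges t)) 1)

      -- A closed trail missing some edge f of C can be rotated to start where a
      -- walk towards f leaves it, and then extended by the leaving edge.
      reroute : ∀ {u T f} → Walk u u T → Unique T → (∀ {e} → e ∈ T → C e) → e₀ ∈ T →
                C f → f ∉ T → LongerThan (length T)
      reroute {u} {T} {f} c uniq sound seed f∈C f∉T with connected e₀∈C f∈C
      ... | P , to-f , P⊆C
        with exit c (tgt-on-circuit c seed) (to-f ++ʷ step refl []) (∈-++-[ f ]-elim P⊆C f∈C)
                  (++⁺ʳ P (here f∉T))
      ... | g , g∈C , g∉T , on with rotate on
      ... | T′ , T′↭T , c′ with extend rotated g∈C refl (g∉T ∘ ∈-resp-↭ T′↭T)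
        where
        rotated : Trail
        rotated = record { start = src g ; end = src g ; edges = T′ ; walk = c′
                         ; unique = Unique-resp-↭ (↭-sym T′↭T) uniq
                         ; sound = sound ∘ ∈-resp-↭ T′↭T
                         ; seed = ∈-resp-↭ (↭-sym T′↭T) seed }
      ... | t , longer = t , trans longer (cong suc (↭-length T′↭T))

      close-up : ∀ {u T} → Walk u u T → Unique T → (∀ {e} → e ∈ T → C e) → e₀ ∈ T →
                 EulerCircuit ⊎ LongerThan (length T)
      close-up {u} {T} c uniq sound seed with Any.any? (λ f → C? f ×-dec ¬? (f ∈? T)) allEdges
      ... | yes missing with find missing
      ...   | f , _ , f∈C , f∉T = inj₂ (reroute c uniq sound seed f∈C f∉T)
      close-up {u} {T} c uniq sound seed | no covered =
        inj₁ record { start = u ; edges = T ; walk = c ; unique = uniq ; sound = sound ; complete = covers }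
        where
        covers : ∀ {e} → C e → e ∈ T
        covers {e} e∈C with e ∈? T
        ... | yes e∈T = e∈T
        ... | no  e∉T = contradiction (lose (enumerates e) (e∈C , e∉T)) covered

      -- One round: extend the trail by an unused edge leaving its end if there
      -- is one; otherwise the trail is closed and `close-up` applies.
      grow : (t : Trail) → EulerCircuit ⊎ LongerThan (length (Trail.edges t))
      grow t with balanced (Trail.end t)
      ... | O , _ with Any.any? (λ e → ¬? (e ∈? Trail.edges t)) (Listing.elems O)
      ... | yes unused with find unused
      ...   | e , e∈O , e∉T with Listing.sound O e∈O
      ...     | e∈C , v↦e = inj₂ (extend t e∈C v↦e e∉T)
      grow t | O , _ | no none =
        close-up (subst (λ v → Walk v (Trail.end t) (Trail.edges t)) closed (Trail.walk t))
                 (Trail.unique t) (Trail.sound t) (Trail.seed t)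
        where
        used-up : ∀ {e} → OutEdge (Trail.end t) e → e ∈ Trail.edges t
        used-up out with _ ∈? Trail.edges t
        ... | yes e∈T = e∈T
        ... | no  e∉T = contradiction (lose (Listing.complete O out) e∉T) none
        closed : Trail.start t ≡ Trail.end t
        closed = stuck⇒closed balanced (Trail.walk t) (Trail.unique t) (Trail.sound t) used-up

      -- Trails are never longer than the list of all edges ...
      trail-bounded : (t : Trail) → length (Trail.edges t) ≤ length allEdges
      trail-bounded t = Unique⇒length≤ (Trail.unique t) (λ {e} _ → enumerates e)

      -- ... so growing a trail whose length plus the fuel exceeds that bound
      -- must end in an Eulerian circuit.
      iterate : (fuel : ℕ) (t : Trail) → length allEdges < length (Trail.edges t) + fuel → EulerCircuit
      iterate zero       t bound =
        contradiction (trail-bounded t) (<⇒≱ (subst (length allEdges <_) (+-identityʳ _) bound))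
      iterate (suc fuel) t bound with grow t
      ... | inj₁ circuit       = circuit
      ... | inj₂ (t′ , longer) = iterate fuel t′ (subst (length allEdges <_) shift-fuel bound)
        where
        shift-fuel : length (Trail.edges t) + suc fuel ≡ length (Trail.edges t′) + fuel
        shift-fuel = trans (+-suc _ fuel) (cong (_+ fuel) (sym longer))

      initial : Trail
      initial = record { start = src e₀ ; end = tgt e₀ ; edges = [ e₀ ] ; walk = step refl []
                       ; unique = [] ∷ [] ; sound = λ { (here refl) → e₀∈C } ; seed = here refl }

      euler-circuit : EulerCircuit
      euler-circuit = iterate (length allEdges) initial (n<1+n (length allEdges))

module _ {A : Set} where

  lookup-tail : ∀ {m} (e : Vec A (suc m)) (j : Fin m) → lookup e (suc j) ≡ lookup (tail e) j
  lookup-tail (_ ∷ _) _ = refl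

  lookup-init : ∀ {m} (e : Vec A (suc m)) (j : Fin m) → lookup (init e) j ≡ lookup e (inject₁ j)
  lookup-init (_ ∷ _ ∷ _) zero    = refl
  lookup-init (_ ∷ e)     (suc j) = lookup-init e j

  init-∷ʳ-last : ∀ {m} (e : Vec A (suc m)) → init e ∷ʳ last e ≡ e
  init-∷ʳ-last e = sym (proj₂ (proj₂ (initLast e)))

  ∈-∷ʳ⁻ : ∀ {m} (v : Vec A m) {a b} → b ∈ᵥ v ∷ʳ a → b ∈ᵥ a ∷ v
  ∈-∷ʳ⁻ []      b∈ = b∈
  ∈-∷ʳ⁻ (_ ∷ v) (here b≡x) = there (here b≡x)
  ∈-∷ʳ⁻ (_ ∷ v) (there b∈) with ∈-∷ʳ⁻ v b∈
  ... | here b≡a  = here b≡a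
  ... | there b∈v = there (there b∈v)

  ∈-∷ʳ⁺ : ∀ {m} (v : Vec A m) {a b} → b ∈ᵥ a ∷ v → b ∈ᵥ v ∷ʳ a
  ∈-∷ʳ⁺ []      b∈                 = b∈
  ∈-∷ʳ⁺ (_ ∷ v) (here b≡a)         = there (∈-∷ʳ⁺ v (here b≡a))
  ∈-∷ʳ⁺ (_ ∷ v) (there (here b≡x)) = here b≡x
  ∈-∷ʳ⁺ (_ ∷ v) (there (there b∈)) = there (∈-∷ʳ⁺ v (there b∈))

  ∈-tail : ∀ {m} (e : Vec A (suc m)) {b} → b ∈ᵥ tail e → b ∈ᵥ e
  ∈-tail (_ ∷ _) b∈ = there b∈

  ∈-init : ∀ {m} (e : Vec A (suc m)) {b} → b ∈ᵥ init e → b ∈ᵥ e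
  ∈-init e b∈ = subst (_ ∈ᵥ_) (init-∷ʳ-last e) (∈-∷ʳ⁺ (init e) (there b∈))

  toList-tail-++ : ∀ {m} (w : Vec A (suc m)) (zs : List A) → toList (tail w) ++ zs ≡ drop 1 (toList w ++ zs)
  toList-tail-++ (_ ∷ _) _ = refl

  drop-toList-++ : ∀ {m} (v : Vec A m) (zs : List A) → drop m (toList v ++ zs) ≡ zs
  drop-toList-++ []      _  = refl
  drop-toList-++ (_ ∷ v) zs = drop-toList-++ v zs

  toList-injective′ : ∀ {m} (v w : Vec A m) → toList v ≡ toList w → v ≡ w
  toList-injective′ v w eq = trans (sym (cast-is-id refl v)) (toList-injective refl v w eq)

  ∉-replicate : ∀ {m} {b c : A} → b ≢ c → b ∉ᵥ replicate m c
  ∉-replicate b≢c (here b≡c) = b≢c b≡c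
  ∉-replicate b≢c (there b∈) = ∉-replicate b≢c b∈

-- The word graph: vertices are words of length n, and a word e of length
-- n+1 is an edge from init e to tail e.

module WordGraph (k n : ℕ) where

  open Eulerian {Word n k} {Word (suc n) k} (≡-dec _≟_) (≡-dec _≟_) init tail public

  -- The first letters of the edges of a closed walk form a cyclic sequence
  -- whose windows are exactly these edges.
  module Reading {u e T} (c : Walk u u (e ∷ T)) where

    L : ℕ
    L = suc (length T)

    letters : Fin L → Fin k
    letters i = lookup (List.lookup (e ∷ T) i) zero

    edge : ℕ → Word (suc n) k
    edge r = List.lookup (e ∷ T) (r mod L)

    suc-% : ∀ r → suc (r % L) % L ≡ suc r % L
    suc-% r = begin
      suc (r % L) % L          ≡⟨ %-distribˡ-+ 1 (r % L) L ⟩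
      (1 % L + r % L % L) % L  ≡⟨ cong (λ x → (1 % L + x) % L) (m%n%n≡m%n r L) ⟩
      (1 % L + r % L) % L      ≡⟨ sym (%-distribˡ-+ 1 r L) ⟩
      suc r % L                ∎
      where open ≡-Reasoning

    successive : ∀ r → tail (edge r) ≡ init (edge (suc r))
    successive r = trans (closed-walk-next c (r mod L)) (cong (init ∘ List.lookup (e ∷ T)) next-index)
      where
      next-index : suc (toℕ (r mod L)) mod L ≡ suc r mod L
      next-index = fromℕ<-cong _ _ (trans (cong (λ x → suc x % L) (toℕ-fromℕ< _)) (suc-% r)) _ _

    letter-at : ∀ j r (i : Fin (suc n)) → toℕ i ≡ j → lookup (edge r) i ≡ lookup (edge (r + j)) zero
    letter-at zero    r zero    refl = cong (λ x → lookup (edge x) zero) (sym (+-identityʳ r))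
    letter-at (suc j) r (suc i) refl = begin
      lookup (edge r) (suc i)                  ≡⟨ lookup-tail (edge r) i ⟩
      lookup (tail (edge r)) i                 ≡⟨ cong (λ w → lookup w i) (successive r) ⟩
      lookup (init (edge (suc r))) i           ≡⟨ lookup-init (edge (suc r)) i ⟩
      lookup (edge (suc r)) (inject₁ i)        ≡⟨ letter-at (toℕ i) (suc r) (inject₁ i) (toℕ-inject₁ i) ⟩
      lookup (edge (suc r + toℕ i)) zero       ≡⟨ cong (λ x → lookup (edge x) zero) (sym (+-suc r (toℕ i))) ⟩
      lookup (edge (r + suc (toℕ i))) zero     ∎
      where open ≡-Reasoning

    window≡edge : ∀ i → window (suc n) letters i ≡ List.lookup (e ∷ T) i
    window≡edge i = begin
      window (suc n) letters i          ≡⟨ tabulate-cong (λ j → sym (letter-at (toℕ j) (toℕ i) j refl)) ⟩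
      tabulate (lookup (edge (toℕ i)))  ≡⟨ tabulate∘lookup (edge (toℕ i)) ⟩
      edge (toℕ i)                      ≡⟨ cong (List.lookup (e ∷ T)) i-mod ⟩
      List.lookup (e ∷ T) i             ∎
      where
      open ≡-Reasoning
      i-mod : toℕ i mod L ≡ i
      i-mod = toℕ-injective (trans (toℕ-fromℕ< _) (m<n⇒m%n≡m (toℕ<n i)))

  module _ {C : Word (suc n) k → Set} where
    open EdgeSet C

    circuit⇒ucycle : EulerCircuit → ∀ {e} → C e → ∃[ m ] ∃[ x ] IsUCycle {m} {k} (suc n) C x
    circuit⇒ucycle record { edges = [] ; complete = complete } e∈C with complete e∈C
    ... | ()
    circuit⇒ucycle record { edges = e ∷ T ; walk = c ; unique = uniq ; sound = sound ; complete = complete } _ =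
      length T , letters , distinct , in-C , covering
      where
      open Reading c
      distinct : ∀ i j → window (suc n) letters i ≡ window (suc n) letters j → i ≡ j
      distinct i j eq = lookup-injective uniq (trans (sym (window≡edge i)) (trans eq (window≡edge j)))
      in-C : ∀ i → C (window (suc n) letters i)
      in-C i = subst C (sym (window≡edge i)) (sound (∈-lookup i))
      covering : ∀ w → C w → ∃[ i ] window (suc n) letters i ≡ w
      covering w w∈C = index w∈T , trans (window≡edge (index w∈T)) (sym (lookup-index w∈T))
        where
        w∈T : w ∈ e ∷ T
        w∈T = complete w∈C

nonzero-avoiding : ∀ {j} (b : Fin (suc (suc (suc j)))) → ∃[ c ] (c ≢ zero × c ≢ b)
nonzero-avoiding b with suc zero ≟ b
... | yes refl = suc (suc zero) , (λ ()) , (λ ())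
... | no  1≢b  = suc zero , (λ ()) , 1≢b

third-letter : ∀ {k} → 2 < k → (b b′ : Fin k) → ∃[ c ] (c ≢ b × c ≢ b′)
third-letter (s≤s (s≤s (s≤s _))) b b′ with zero ≟ b | zero ≟ b′
... | no 0≢b   | no 0≢b′  = zero , 0≢b , 0≢b′
... | yes refl | _        = nonzero-avoiding b′
... | no _     | yes refl with nonzero-avoiding b
...   | c , c≢0 , c≢b = c , c≢b , c≢0

module NonOnto (k n : ℕ) where

  open WordGraph k n
  open EdgeSet (NotOnto {suc n} {k})
  open VecMembership (_≟_ {k}) using () renaming (_∈?_ to _∈ᵥ?_)

  NotOnto? : ∀ {m} → Decidable (NotOnto {m} {k})
  NotOnto? w = any? (λ a → ¬? (a ∈ᵥ? w))

  allWords : ∀ m → List (Word m k)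
  allWords zero    = [ [] ]
  allWords (suc m) = cartesianProductWith _∷_ (allFin k) (allWords m)

  allWords-complete : ∀ {m} (w : Word m k) → w ∈ allWords m
  allWords-complete []      = here refl
  allWords-complete (a ∷ w) = ∈-cartesianProductWith⁺ _∷_ (∈-allFin a) (allWords-complete w)

  -- Balance: the edges leaving v are the v·a, those entering v the a·v, and
  -- v·a omits a letter exactly when a·v does.

  NotOnto-∷ʳ : ∀ (v : Word n k) → (λ a → NotOnto (v ∷ʳ a)) ≐ (λ a → NotOnto (a ∷ v))
  NotOnto-∷ʳ v = (λ { (b , b∉) → b , b∉ ∘ ∈-∷ʳ⁺ v }) , (λ { (b , b∉) → b , b∉ ∘ ∈-∷ʳ⁻ v })

  out-letters in-letters : Word n k → List (Fin k)
  out-letters v = filter (λ a → NotOnto? (v ∷ʳ a)) (allFin k)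
  in-letters  v = filter (λ a → NotOnto? (a ∷ v)) (allFin k)

  out-listing : ∀ v → Listing (OutEdge v)
  out-listing v = record
    { elems    = map (v ∷ʳ_) (out-letters v)
    ; unique   = map⁺ (∷ʳ-injectiveʳ v v) (filter⁺ _ (allFin⁺ k))
    ; sound    = sound
    ; complete = complete
    }
    where
    sound : ∀ {e} → e ∈ map (v ∷ʳ_) (out-letters v) → OutEdge v e
    sound e∈ with ∈-map⁻ (v ∷ʳ_) e∈
    ... | a , a∈ , refl = proj₂ (∈-filter⁻ (λ a → NotOnto? (v ∷ʳ a)) {xs = allFin k} a∈) , init-∷ʳ a v
    complete : ∀ {e} → OutEdge v e → e ∈ map (v ∷ʳ_) (out-letters v)
    complete {e} (e∈C , refl) = subst (_∈ map (init e ∷ʳ_) (out-letters (init e))) (init-∷ʳ-last e)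
      (∈-map⁺ (init e ∷ʳ_) (∈-filter⁺ (λ a → NotOnto? (init e ∷ʳ a)) (∈-allFin (last e))
        (subst NotOnto (sym (init-∷ʳ-last e)) e∈C)))

  in-listing : ∀ v → Listing (InEdge v)
  in-listing v = record
    { elems    = map (_∷ v) (in-letters v)
    ; unique   = map⁺ ∷-injectiveˡ (filter⁺ _ (allFin⁺ k))
    ; sound    = sound
    ; complete = complete
    }
    where
    sound : ∀ {e} → e ∈ map (_∷ v) (in-letters v) → InEdge v e
    sound e∈ with ∈-map⁻ (_∷ v) e∈
    ... | a , a∈ , refl = proj₂ (∈-filter⁻ (λ a → NotOnto? (a ∷ v)) {xs = allFin k} a∈) , refl
    complete : ∀ {e} → InEdge v e → e ∈ map (_∷ v) (in-letters v)
    complete {a ∷ _} (e∈C , refl) = ∈-map⁺ (_∷ v) (∈-filter⁺ (λ a → NotOnto? (a ∷ v)) (∈-allFin a) e∈C)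

  balanced : Balanced
  balanced v = out-listing v , in-listing v , (begin
    length (map (v ∷ʳ_) (out-letters v))  ≡⟨ length-map (v ∷ʳ_) (out-letters v) ⟩
    length (out-letters v)                ≡⟨ cong length (filter-≐ _ _ (NotOnto-∷ʳ v) (allFin k)) ⟩
    length (in-letters v)                 ≡⟨ sym (length-map (_∷ v) (in-letters v)) ⟩
    length (map (_∷ v) (in-letters v))    ∎)
    where open ≡-Reasoning

  -- Connectivity: shifting the letters of t into v one at a time walks from
  -- v to t, and if v and t omit a letter b, so does every edge on the way.

  push : ∀ {m} → Word n k → Vec (Fin k) m → Word n k
  push v []      = v
  push v (a ∷ t) = push (tail (v ∷ʳ a)) t

  pushed-edges : ∀ {m} → Word n k → Vec (Fin k) m → List (Word (suc n) k)
  pushed-edges v []      = []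
  pushed-edges v (a ∷ t) = (v ∷ʳ a) ∷ pushed-edges (tail (v ∷ʳ a)) t

  push-walk : ∀ {m} (v : Word n k) (t : Vec (Fin k) m) → Walk v (push v t) (pushed-edges v t)
  push-walk v []      = []
  push-walk v (a ∷ t) = step (init-∷ʳ a v) (push-walk (tail (v ∷ʳ a)) t)

  toList-push : ∀ {m} (v : Word n k) (t : Vec (Fin k) m) → toList (push v t) ≡ drop m (toList v ++ toList t)
  toList-push v []            = sym (++-identityʳ (toList v))
  toList-push {suc m} v (a ∷ t) = begin
    toList (push (tail (v ∷ʳ a)) t)                    ≡⟨ toList-push (tail (v ∷ʳ a)) t ⟩
    drop m (toList (tail (v ∷ʳ a)) ++ toList t)        ≡⟨ cong (drop m) (toList-tail-++ (v ∷ʳ a) (toList t)) ⟩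
    drop m (drop 1 (toList (v ∷ʳ a) ++ toList t))
      ≡⟨ cong (λ xs → drop m (drop 1 (xs ++ toList t))) (toList-∷ʳ a v) ⟩
    drop m (drop 1 ((toList v ++ [ a ]) ++ toList t))
      ≡⟨ cong (drop m ∘ drop 1) (++-assoc (toList v) [ a ] (toList t)) ⟩
    drop m (drop 1 (toList v ++ a ∷ toList t))         ≡⟨ drop-drop 1 m (toList v ++ a ∷ toList t) ⟩
    drop (suc m) (toList v ++ a ∷ toList t)            ∎
    where open ≡-Reasoning

  push-all : (v t : Word n k) → push v t ≡ t
  push-all v t = toList-injective′ (push v t) t (trans (toList-push v t) (drop-toList-++ v (toList t)))

  walk-between : (v t : Word n k) → Walk v t (pushed-edges v t)
  walk-between v t = subst (λ w → Walk v w (pushed-edges v t)) (push-all v t) (push-walk v t)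

  pushed-edges-omit : ∀ {m b} (v : Word n k) (t : Vec (Fin k) m) → b ∉ᵥ v → b ∉ᵥ t →
                      ∀ {e} → e ∈ pushed-edges v t → b ∉ᵥ e
  pushed-edges-omit v (a ∷ t) b∉v b∉t (here refl) b∈ with ∈-∷ʳ⁻ v b∈
  ... | here b≡a = b∉t (here b≡a)
  ... | there b∈v = b∉v b∈v
  pushed-edges-omit {b = b} v (a ∷ t) b∉v b∉t (there e∈) =
    pushed-edges-omit (tail (v ∷ʳ a)) t b∉next (b∉t ∘ there) e∈
    where
    b∉next : b ∉ᵥ tail (v ∷ʳ a)
    b∉next = pushed-edges-omit v (a ∷ t) b∉v b∉t (here refl) ∘ ∈-tail (v ∷ʳ a)

  -- Any two non-onto words are joined by a walk of non-onto words: from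
  -- tail e (omitting b) to cⁿ and on to init f (omitting b′), where c ≠ b, b′.
  connected : 2 < k → Connected
  connected 2<k {e} {f} (b , b∉e) (b′ , b′∉f) with third-letter 2<k b b′
  ... | c , c≢b , c≢b′ =
    pushed-edges (tail e) cⁿ ++ pushed-edges cⁿ (init f) ,
    walk-between (tail e) cⁿ ++ʷ walk-between cⁿ (init f) ,
    omits
    where
    cⁿ : Word n k
    cⁿ = replicate n c
    omits : ∀ {d} → d ∈ pushed-edges (tail e) cⁿ ++ pushed-edges cⁿ (init f) → NotOnto d
    omits d∈ with ∈-++⁻ (pushed-edges (tail e) cⁿ) d∈
    ... | inj₁ d∈₁ = b  , pushed-edges-omit (tail e) cⁿ (b∉e ∘ ∈-tail e) (∉-replicate (c≢b ∘ sym)) d∈₁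
    ... | inj₂ d∈₂ = b′ , pushed-edges-omit cⁿ (init f) (∉-replicate (c≢b′ ∘ sym)) (b′∉f ∘ ∈-init f) d∈₂

  some-not-onto : 1 < k → ∃[ e ] NotOnto {suc n} {k} e
  some-not-onto (s≤s (s≤s _)) = replicate (suc n) zero , suc zero , ∉-replicate (λ ())

theorem6 : (n k : ℕ) → 2 < k → k ≤ n →
    ∃[ m ] ∃[ x ] IsUCycle {m} {k} n NotOnto x
theorem6 zero    k 2<k k≤0 = contradiction (≤-trans 2<k k≤0) λ ()
theorem6 (suc n) k 2<k _   = circuit⇒ucycle euler-circuit (proj₂ (some-not-onto (<⇒≤ 2<k)))
  where
  open NonOnto k n
  open WordGraph k n using (module EdgeSet; circuit⇒ucycle)
  open EdgeSet NotOnto using (module Hierholzer)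
  open Hierholzer NotOnto? (allWords (suc n)) allWords-complete balanced (connected 2<k)
                  (proj₂ (some-not-onto (<⇒≤ 2<k)))
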